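{- Let $A\in\mathbb{R}^{r\times s}$, $\mathbf{v}\in\mathbb{R}^r$, $\mathbf{u}\in\mathbb{R}^s$, $\mathbf{x}\in\mathbb{R}^t$, $\mathbf{y}\in\mathbb{R}^w$ and $B\in\mathbb{R}^{w\times t}$, and suppose $$M=\begin{bmatrix}A & \mathbf{v}\\ \mathbf{u}^T & 0\end{bmatrix}\quad\text{and}\quad N=\begin{bmatrix}0 & \mathbf{x}^T\\ \mathbf{y} & B\end{bmatrix}$$ are row orthogonal ($MM^T=I$, $NN^T=I$), with $\mathbf{x},\mathbf{y},\mathbf{u},\mathbf{v}$ nowhere zero. Then $$Q=\begin{bmatrix}A & \mathbf{v}\mathbf{x}^T\\ \mathbf{y}\mathbf{u}^T & B\end{bmatrix}$$ is row orthogonal. Moreover, if both $M$ and $N$ have the strong inner product property, then $Q$ has the strong inner product property.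
   Context: All matrices are real; $\circ$ denotes the Hadamard product; a vector is nowhere zero if all its entries are nonzero. A matrix $P\in\mathbb{R}^{p\times q}$ with $p\le q$ has the strong inner product property (SIPP) if $P$ has rank $p$ and $X=O$ is the only symmetric $p\times p$ matrix $X$ with $(XP)\circ P=O$. -}

module Defs where

open import Level using (0ℓ)
open import Data.Nat using (ℕ; zero; suc) renaming (_+_ to _+ℕ_; _≤_ to _≤ℕ_)
open import Data.Fin using (Fin; zero; suc; splitAt)
open import Data.Sum using (_⊎_; inj₁; inj₂)
open import Data.Product using (_×_; Σ; ∃; _,_)
open import Relation.Binary.PropositionalEquality using (_≡_; _≢_)
open import Relation.Nullary using (¬_)
open import Algebra.Structures using (IsCommutativeRing)
open import Relation.Binary.Structures using (IsTotalOrder)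

-- The real numbers, axiomatised as a complete ordered field
-- (any model; all models are isomorphic).  Equality is propositional.

record RealField : Set₁ where
  infixl 6 _+_
  infixl 7 _*_
  infix  4 _≤_
  field
    ℝ    : Set
    _+_  : ℝ → ℝ → ℝ
    _*_  : ℝ → ℝ → ℝ
    -_   : ℝ → ℝ
    0#   : ℝ
    1#   : ℝ
    _≤_  : ℝ → ℝ → Set
    isCommutativeRing : IsCommutativeRing _≡_ _+_ _*_ -_ 0# 1#
    0≢1  : 0# ≢ 1#
    inverse : ∀ x → x ≢ 0# → Σ ℝ (λ y → x * y ≡ 1#)
    isTotalOrder : IsTotalOrder _≡_ _≤_
    +-mono-≤ : ∀ {x y} z → x ≤ y → x + z ≤ y + z
    *-nonneg : ∀ {x y} → 0# ≤ x → 0# ≤ y → 0# ≤ x * y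
    complete : (S : ℝ → Set) → ∃ S → ∃ (λ b → ∀ x → S x → x ≤ b) →
               ∃ (λ s → (∀ x → S x → x ≤ s) × (∀ b → (∀ x → S x → x ≤ b) → s ≤ b))

module Matrices (R : RealField) where
  open RealField R

  Mat : ℕ → ℕ → Set
  Mat m n = Fin m → Fin n → ℝ

  Vect : ℕ → Set
  Vect n = Fin n → ℝ

  sum : ∀ {n} → (Fin n → ℝ) → ℝ
  sum {zero}  f = 0#
  sum {suc n} f = f zero + sum (λ i → f (suc i))

  _·_ : ∀ {m n k} → Mat m n → Mat n k → Mat m k
  (P · Q) i j = sum (λ l → P i l * Q l j)

  _ᵀ : ∀ {m n} → Mat m n → Mat n m
  (P ᵀ) i j = P j i

  O : ∀ {m n} → Mat m n
  O i j = 0#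

  I : ∀ {n} → Mat n n
  I zero    zero    = 1#
  I zero    (suc j) = 0#
  I (suc i) zero    = 0#
  I (suc i) (suc j) = I i j

  _∘_ : ∀ {m n} → Mat m n → Mat m n → Mat m n
  (P ∘ Q) i j = P i j * Q i j

  block : ∀ {a b c d} → Mat a c → Mat a d → Mat b c → Mat b d → Mat (a +ℕ b) (c +ℕ d)
  block {a} {b} {c} {d} P₁₁ P₁₂ P₂₁ P₂₂ i j with splitAt a i | splitAt c j
  ... | inj₁ i' | inj₁ j' = P₁₁ i' j'
  ... | inj₁ i' | inj₂ j' = P₁₂ i' j'
  ... | inj₂ i' | inj₁ j' = P₂₁ i' j'
  ... | inj₂ i' | inj₂ j' = P₂₂ i' j'

  col : ∀ {n} → Vect n → Mat n 1
  col v i _ = v i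

  row : ∀ {n} → Vect n → Mat 1 n
  row u _ j = u j

  outer : ∀ {m n} → Vect m → Vect n → Mat m n
  outer v x i j = v i * x j

  NowhereZero : ∀ {n} → Vect n → Set
  NowhereZero v = ∀ i → v i ≢ 0#

  RowOrthogonal : ∀ {m n} → Mat m n → Set
  RowOrthogonal P = ∀ i j → (P · (P ᵀ)) i j ≡ I i j

  FullRowRank : ∀ {p q} → Mat p q → Set
  FullRowRank {p} P = ∀ (c : Vect p) → (∀ j → sum (λ i → c i * P i j) ≡ 0#) → ∀ i → c i ≡ 0#

  Symmetric : ∀ {n} → Mat n n → Set
  Symmetric X = ∀ i j → X i j ≡ X j i

  SIPP : ∀ {p q} → Mat p q → Set
  SIPP {p} {q} P =
    p ≤ℕ q × FullRowRank P ×
    (∀ (X : Mat p p) → Symmetric X → (∀ i j → ((X · P) ∘ P) i j ≡ 0#) → ∀ i j → X i j ≡ 0#)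

module Submission where

-- Q Qᵀ agrees blockwise with M Mᵀ and N Nᵀ, because x and u are unit vectors orthogonal to the
-- rows of B and A respectively.  For the SIPP, write a symmetric X with (XQ)∘Q = O in blocks
-- [X₁₁ X₁₂; X₂₁ X₂₂].  As v xᵀ and y uᵀ are nowhere zero, the off-diagonal blocks of XQ vanish:
-- (X₁₁v) xᵀ + X₁₂B = O and X₂₁A + (X₂₂y) uᵀ = O, and pairing with the unit vectors x and u
-- separates the two summands, so X₁₁v, X₁₂B, X₂₂y and X₂₁A all vanish.  Then
-- X′ = [X₁₁ X₁₂y; (X₁₂y)ᵀ 0] satisfies (X′M)∘M = O and X″ = [0 (X₂₁v)ᵀ; X₂₁v X₂₂] satisfies
-- (X″N)∘N = O, so the SIPP of M and N gives X₁₁ = O, X₁₂y = 0 and X₂₂ = O.  Finally each row z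
-- of X₁₂ has (0, z) N = (zy, zB) = 0, so z = 0 because N has independent rows.

open import Defs
open import Data.Nat using (ℕ; zero; suc) renaming (_+_ to _+ℕ_)
import Data.Nat.Properties as ℕ
open import Data.Fin using (Fin; zero; suc; _↑ˡ_; _↑ʳ_)
open import Data.Fin.Properties using (splitAt-↑ˡ; splitAt-↑ʳ)
open import Data.Vec.Functional using (take; drop; _∷_)
open import Data.Product using (_×_; _,_; proj₁; proj₂)
open import Algebra.Bundles using (CommutativeRing)
import Algebra.Properties.CommutativeSemigroup as CommutativeSemigroupProperties
open import Relation.Binary.PropositionalEquality

↑-elim : ∀ m {n} {C : Fin (m +ℕ n) → Set} →
         (∀ i → C (i ↑ˡ n)) → (∀ j → C (m ↑ʳ j)) → ∀ k → C k
↑-elim zero    left right k       = right k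
↑-elim (suc m) left right zero    = left zero
↑-elim (suc m) left right (suc k) = ↑-elim m (λ i → left (suc i)) right k

↑-elim² : ∀ a {b} c {d} {C : Fin (a +ℕ b) → Fin (c +ℕ d) → Set} →
          (∀ i j → C (i ↑ˡ b) (j ↑ˡ d)) → (∀ i j → C (i ↑ˡ b) (c ↑ʳ j)) →
          (∀ i j → C (a ↑ʳ i) (j ↑ˡ d)) → (∀ i j → C (a ↑ʳ i) (c ↑ʳ j)) →
          ∀ p q → C p q
↑-elim² a {b} c {d} {C} C₁₁ C₁₂ C₂₁ C₂₂ =
  ↑-elim a (λ i → ↑-elim c {C = C (i ↑ˡ b)} (C₁₁ i) (C₁₂ i))
           (λ i → ↑-elim c {C = C (a ↑ʳ i)} (C₂₁ i) (C₂₂ i))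

module _ (R : RealField) where
  open RealField R
  open Matrices R

  private
    commutativeRing : CommutativeRing _ _
    commutativeRing = record { isCommutativeRing = isCommutativeRing }

  open CommutativeRing commutativeRing
    using ( +-identityˡ; +-identityʳ; +-assoc; +-comm; *-identityʳ; *-comm; *-assoc
          ; zeroˡ; zeroʳ; distribˡ; distribʳ
          ; +-commutativeSemigroup; *-commutativeSemigroup)
  private
    module + = CommutativeSemigroupProperties +-commutativeSemigroup
    module * = CommutativeSemigroupProperties *-commutativeSemigroup
  open ≡-Reasoning

  x*y≡0⇒x≡0 : ∀ {x y} → y ≢ 0# → x * y ≡ 0# → x ≡ 0#
  x*y≡0⇒x≡0 {x} {y} y≢0 xy≡0 with inverse y y≢0
  ... | y⁻¹ , yy⁻¹≡1 = begin
    x              ≡⟨ sym (*-identityʳ x) ⟩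
    x * 1#         ≡⟨ cong (x *_) yy⁻¹≡1 ⟨
    x * (y * y⁻¹)  ≡⟨ *-assoc x y y⁻¹ ⟨
    (x * y) * y⁻¹  ≡⟨ cong (_* y⁻¹) xy≡0 ⟩
    0# * y⁻¹       ≡⟨ zeroˡ y⁻¹ ⟩
    0#             ∎

  *-nonzero : ∀ {x y} → x ≢ 0# → y ≢ 0# → x * y ≢ 0#
  *-nonzero x≢0 y≢0 xy≡0 = x≢0 (x*y≡0⇒x≡0 y≢0 xy≡0)

  x+0≡y⇒x≡y : ∀ {x z y} → z ≡ 0# → x + z ≡ y → x ≡ y
  x+0≡y⇒x≡y {x} z≡0 x+z≡y = trans (sym (+-identityʳ x)) (trans (cong (x +_) (sym z≡0)) x+z≡y)

  0+x≡y⇒x≡y : ∀ {z x y} → z ≡ 0# → z + x ≡ y → x ≡ y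
  0+x≡y⇒x≡y {z} {x} z≡0 z+x≡y = x+0≡y⇒x≡y z≡0 (trans (+-comm x z) z+x≡y)

  sum-cong : ∀ {n} {f g : Vect n} → f ≗ g → sum f ≡ sum g
  sum-cong {zero}  f≗g = refl
  sum-cong {suc n} f≗g = cong₂ _+_ (f≗g zero) (sum-cong (λ i → f≗g (suc i)))

  sum-zero : ∀ {n} {f : Vect n} → (∀ i → f i ≡ 0#) → sum f ≡ 0#
  sum-zero {zero}  f≡0 = refl
  sum-zero {suc n} f≡0 =
    trans (cong₂ _+_ (f≡0 zero) (sum-zero (λ i → f≡0 (suc i)))) (+-identityˡ 0#)

  sum-+ : ∀ {n} (f g : Vect n) → sum (λ i → f i + g i) ≡ sum f + sum g
  sum-+ {zero}  f g = sym (+-identityˡ 0#)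
  sum-+ {suc n} f g =
    trans (cong (f zero + g zero +_) (sum-+ (λ i → f (suc i)) (λ i → g (suc i))))
          (+.interchange _ _ _ _)

  sum-*ˡ : ∀ {n} c (f : Vect n) → sum (λ i → c * f i) ≡ c * sum f
  sum-*ˡ {zero}  c f = sym (zeroʳ c)
  sum-*ˡ {suc n} c f =
    trans (cong (c * f zero +_) (sum-*ˡ c (λ i → f (suc i)))) (sym (distribˡ c _ _))

  sum-comm : ∀ {m n} (f : Fin m → Fin n → ℝ) →
             sum (λ i → sum (f i)) ≡ sum (λ j → sum (λ i → f i j))
  sum-comm {zero}  {n} f = sym (sum-zero {n} (λ _ → refl))
  sum-comm {suc m} f =
    trans (cong (sum (f zero) +_) (sum-comm (λ i → f (suc i)))) (sym (sum-+ (f zero) _))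

  sum-↑ : ∀ m {n} (f : Vect (m +ℕ n)) → sum f ≡ sum (take m f) + sum (drop m f)
  sum-↑ zero    f = sym (+-identityˡ _)
  sum-↑ (suc m) f = trans (cong (f zero +_) (sum-↑ m (λ i → f (suc i)))) (sym (+-assoc _ _ _))

  ⟨_,_⟩ : ∀ {n} → Vect n → Vect n → ℝ
  ⟨ f , g ⟩ = sum (λ k → f k * g k)

  ⟨⟩-cong : ∀ {n} {f f′ g g′ : Vect n} → f ≗ f′ → g ≗ g′ → ⟨ f , g ⟩ ≡ ⟨ f′ , g′ ⟩
  ⟨⟩-cong f≗f′ g≗g′ = sum-cong (λ k → cong₂ _*_ (f≗f′ k) (g≗g′ k))

  ⟨⟩-congˡ : ∀ {n} {f f′ : Vect n} (g : Vect n) → f ≗ f′ → ⟨ f , g ⟩ ≡ ⟨ f′ , g ⟩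
  ⟨⟩-congˡ g f≗f′ = ⟨⟩-cong f≗f′ (λ _ → refl)

  ⟨⟩-congʳ : ∀ {n} (f : Vect n) {g g′ : Vect n} → g ≗ g′ → ⟨ f , g ⟩ ≡ ⟨ f , g′ ⟩
  ⟨⟩-congʳ f g≗g′ = ⟨⟩-cong (λ _ → refl) g≗g′

  ⟨⟩-comm : ∀ {n} (f g : Vect n) → ⟨ f , g ⟩ ≡ ⟨ g , f ⟩
  ⟨⟩-comm f g = sum-cong (λ k → *-comm (f k) (g k))

  ⟨⟩-zeroˡ : ∀ {n} {f : Vect n} (g : Vect n) → (∀ k → f k ≡ 0#) → ⟨ f , g ⟩ ≡ 0#
  ⟨⟩-zeroˡ g f≡0 = sum-zero (λ k → trans (cong (_* g k) (f≡0 k)) (zeroˡ (g k)))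

  ⟨⟩-zeroʳ : ∀ {n} (f : Vect n) {g : Vect n} → (∀ k → g k ≡ 0#) → ⟨ f , g ⟩ ≡ 0#
  ⟨⟩-zeroʳ f g≡0 = sum-zero (λ k → trans (cong (f k *_) (g≡0 k)) (zeroʳ (f k)))

  ⟨⟩-*ˡ : ∀ {n} c (f g : Vect n) → ⟨ (λ k → c * f k) , g ⟩ ≡ c * ⟨ f , g ⟩
  ⟨⟩-*ˡ c f g = trans (sum-cong (λ k → *-assoc c (f k) (g k))) (sum-*ˡ c (λ k → f k * g k))

  ⟨⟩-*ʳ : ∀ {n} c (f g : Vect n) → ⟨ f , (λ k → g k * c) ⟩ ≡ ⟨ f , g ⟩ * c
  ⟨⟩-*ʳ c f g = begin
    ⟨ f , (λ k → g k * c) ⟩  ≡⟨ sum-cong (λ k → *.x∙yz≈zx∙y (f k) (g k) c) ⟩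
    ⟨ (λ k → c * f k) , g ⟩  ≡⟨ ⟨⟩-*ˡ c f g ⟩
    c * ⟨ f , g ⟩            ≡⟨ *-comm c _ ⟩
    ⟨ f , g ⟩ * c            ∎

  ⟨⟩-+ˡ : ∀ {n} (f g h : Vect n) → ⟨ (λ k → f k + g k) , h ⟩ ≡ ⟨ f , h ⟩ + ⟨ g , h ⟩
  ⟨⟩-+ˡ f g h = trans (sum-cong (λ k → distribʳ (h k) (f k) (g k)))
                      (sum-+ (λ k → f k * h k) (λ k → g k * h k))

  ⟨⟩-assoc : ∀ {m n} (c : Vect m) (P : Mat m n) (g : Vect n) →
             ⟨ c , (λ i → ⟨ P i , g ⟩) ⟩ ≡ ⟨ (λ l → ⟨ c , (P ᵀ) l ⟩) , g ⟩
  ⟨⟩-assoc c P g = begin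
    sum (λ i → c i * sum (λ l → P i l * g l))    ≡⟨ sum-cong (λ i → sum-*ˡ (c i) (λ l → P i l * g l)) ⟨
    sum (λ i → sum (λ l → c i * (P i l * g l)))  ≡⟨ sum-comm (λ i l → c i * (P i l * g l)) ⟩
    sum (λ l → sum (λ i → c i * (P i l * g l)))  ≡⟨ sum-cong (λ l → ⟨⟩-*ʳ (g l) c (λ i → P i l)) ⟩
    ⟨ (λ l → ⟨ c , (P ᵀ) l ⟩) , g ⟩              ∎

  ⟨⟩-↑ : ∀ m {n} (f g : Vect (m +ℕ n)) →
         ⟨ f , g ⟩ ≡ ⟨ take m f , take m g ⟩ + ⟨ drop m f , drop m g ⟩
  ⟨⟩-↑ m f g = sum-↑ m (λ k → f k * g k)

  ⟨⟩-I : ∀ {n} (f : Vect n) k → ⟨ f , (λ i → I i k) ⟩ ≡ f k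
  ⟨⟩-I f zero = begin
    f zero * 1# + ⟨ (λ i → f (suc i)) , (λ _ → 0#) ⟩
      ≡⟨ cong₂ _+_ (*-identityʳ _) (⟨⟩-zeroʳ (λ i → f (suc i)) (λ _ → refl)) ⟩
    f zero + 0#
      ≡⟨ +-identityʳ _ ⟩
    f zero ∎
  ⟨⟩-I f (suc k) = begin
    f zero * 0# + ⟨ (λ i → f (suc i)) , (λ i → I i k) ⟩
      ≡⟨ cong₂ _+_ (zeroʳ _) (⟨⟩-I (λ i → f (suc i)) k) ⟩
    0# + f (suc k)
      ≡⟨ +-identityˡ _ ⟩
    f (suc k) ∎

  rowOrthogonal⇒fullRowRank : ∀ {p q} (P : Mat p q) → RowOrthogonal P → FullRowRank P
  rowOrthogonal⇒fullRowRank P PPᵀ≡I c cP≡0 k = begin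
    c k                                ≡⟨ ⟨⟩-I c k ⟨
    ⟨ c , (λ i → I i k) ⟩              ≡⟨ ⟨⟩-congʳ c (λ i → PPᵀ≡I i k) ⟨
    ⟨ c , (λ i → ⟨ P i , P k ⟩) ⟩      ≡⟨ ⟨⟩-assoc c P (P k) ⟩
    ⟨ (λ l → ⟨ c , (P ᵀ) l ⟩) , P k ⟩  ≡⟨ ⟨⟩-zeroˡ (P k) cP≡0 ⟩
    0#                                 ∎

  ⟨⟩-outer : ∀ {m n} (v : Vect m) (x : Vect n) → ⟨ x , x ⟩ ≡ 1# →
             ∀ i j → ⟨ outer v x i , outer v x j ⟩ ≡ ⟨ col v i , col v j ⟩
  ⟨⟩-outer v x x·x≡1 i j = begin
    ⟨ outer v x i , outer v x j ⟩            ≡⟨ sum-cong (λ k → *.interchange (v i) (x k) (v j) (x k)) ⟩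
    sum (λ k → (v i * v j) * (x k * x k))    ≡⟨ sum-*ˡ (v i * v j) (λ k → x k * x k) ⟩
    (v i * v j) * ⟨ x , x ⟩                  ≡⟨ cong ((v i * v j) *_) x·x≡1 ⟩
    (v i * v j) * 1#                         ≡⟨ *-identityʳ _ ⟩
    v i * v j                                ≡⟨ +-identityʳ _ ⟨
    ⟨ col v i , col v j ⟩                    ∎

  orthogonal-sum≡0⇒parts≡0 : ∀ {m n} {e : Vect n} {P : Mat m n} (s : ℝ) (g : Vect m) →
    ⟨ e , e ⟩ ≡ 1# → (∀ i → ⟨ e , P i ⟩ ≡ 0#) →
    (∀ j → s * e j + ⟨ g , (P ᵀ) j ⟩ ≡ 0#) →
    s ≡ 0# × (∀ j → ⟨ g , (P ᵀ) j ⟩ ≡ 0#)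
  orthogonal-sum≡0⇒parts≡0 {e = e} {P} s g e·e≡1 e⊥P se+gP≡0 = s≡0 , gP≡0
    where
    gP : Vect _
    gP j = ⟨ g , (P ᵀ) j ⟩

    gP⊥e : ⟨ gP , e ⟩ ≡ 0#
    gP⊥e = trans (sym (⟨⟩-assoc g P e)) (⟨⟩-zeroʳ g (λ i → trans (⟨⟩-comm (P i) e) (e⊥P i)))

    s≡0 : s ≡ 0#
    s≡0 = begin
      s                                      ≡⟨ *-identityʳ s ⟨
      s * 1#                                 ≡⟨ cong (s *_) e·e≡1 ⟨
      s * ⟨ e , e ⟩                          ≡⟨ +-identityʳ _ ⟨
      s * ⟨ e , e ⟩ + 0#                     ≡⟨ cong₂ _+_ (⟨⟩-*ˡ s e e) gP⊥e ⟨
      ⟨ (λ j → s * e j) , e ⟩ + ⟨ gP , e ⟩   ≡⟨ ⟨⟩-+ˡ (λ j → s * e j) gP e ⟨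
      ⟨ (λ j → s * e j + gP j) , e ⟩         ≡⟨ ⟨⟩-zeroˡ e se+gP≡0 ⟩
      0#                                     ∎

    gP≡0 : ∀ j → gP j ≡ 0#
    gP≡0 j = begin
      gP j               ≡⟨ +-identityˡ _ ⟨
      0# + gP j          ≡⟨ cong (_+ gP j) (trans (cong (_* e j) s≡0) (zeroˡ (e j))) ⟨
      s * e j + gP j     ≡⟨ se+gP≡0 j ⟩
      0#                 ∎

  I-↑ˡ-↑ˡ : ∀ m n (i j : Fin m) → I {m +ℕ n} (i ↑ˡ n) (j ↑ˡ n) ≡ I i j
  I-↑ˡ-↑ˡ (suc m) n zero    zero    = refl
  I-↑ˡ-↑ˡ (suc m) n zero    (suc j) = refl
  I-↑ˡ-↑ˡ (suc m) n (suc i) zero    = refl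
  I-↑ˡ-↑ˡ (suc m) n (suc i) (suc j) = I-↑ˡ-↑ˡ m n i j

  I-↑ˡ-↑ʳ : ∀ m n (i : Fin m) (j : Fin n) → I {m +ℕ n} (i ↑ˡ n) (m ↑ʳ j) ≡ 0#
  I-↑ˡ-↑ʳ (suc m) n zero    j = refl
  I-↑ˡ-↑ʳ (suc m) n (suc i) j = I-↑ˡ-↑ʳ m n i j

  I-↑ʳ-↑ˡ : ∀ m n (i : Fin n) (j : Fin m) → I {m +ℕ n} (m ↑ʳ i) (j ↑ˡ n) ≡ 0#
  I-↑ʳ-↑ˡ (suc m) n i zero    = refl
  I-↑ʳ-↑ˡ (suc m) n i (suc j) = I-↑ʳ-↑ˡ m n i j

  I-↑ʳ-↑ʳ : ∀ m n (i j : Fin n) → I {m +ℕ n} (m ↑ʳ i) (m ↑ʳ j) ≡ I i j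
  I-↑ʳ-↑ʳ zero    n i j = refl
  I-↑ʳ-↑ʳ (suc m) n i j = I-↑ʳ-↑ʳ m n i j

  record RowOrthogonalBlocks {a b c d} (P₁₁ : Mat a c) (P₁₂ : Mat a d)
                             (P₂₁ : Mat b c) (P₂₂ : Mat b d) : Set where
    field
      top    : ∀ i j → ⟨ P₁₁ i , P₁₁ j ⟩ + ⟨ P₁₂ i , P₁₂ j ⟩ ≡ I i j
      cross  : ∀ i j → ⟨ P₁₁ i , P₂₁ j ⟩ + ⟨ P₁₂ i , P₂₂ j ⟩ ≡ 0#
      bottom : ∀ i j → ⟨ P₂₁ i , P₂₁ j ⟩ + ⟨ P₂₂ i , P₂₂ j ⟩ ≡ I i j

  module Block {a b c d} (P₁₁ : Mat a c) (P₁₂ : Mat a d) (P₂₁ : Mat b c) (P₂₂ : Mat b d) where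

    P : Mat (a +ℕ b) (c +ℕ d)
    P = block P₁₁ P₁₂ P₂₁ P₂₂

    ↑ˡ-↑ˡ : ∀ i j → P (i ↑ˡ b) (j ↑ˡ d) ≡ P₁₁ i j
    ↑ˡ-↑ˡ i j rewrite splitAt-↑ˡ a i b | splitAt-↑ˡ c j d = refl

    ↑ˡ-↑ʳ : ∀ i j → P (i ↑ˡ b) (c ↑ʳ j) ≡ P₁₂ i j
    ↑ˡ-↑ʳ i j rewrite splitAt-↑ˡ a i b | splitAt-↑ʳ c d j = refl

    ↑ʳ-↑ˡ : ∀ i j → P (a ↑ʳ i) (j ↑ˡ d) ≡ P₂₁ i j
    ↑ʳ-↑ˡ i j rewrite splitAt-↑ʳ a b i | splitAt-↑ˡ c j d = refl

    ↑ʳ-↑ʳ : ∀ i j → P (a ↑ʳ i) (c ↑ʳ j) ≡ P₂₂ i j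
    ↑ʳ-↑ʳ i j rewrite splitAt-↑ʳ a b i | splitAt-↑ʳ c d j = refl

    ·-↑ˡ : ∀ {m} (Y : Mat m (a +ℕ b)) p j →
           (Y · P) p (j ↑ˡ d) ≡ ⟨ take a (Y p) , (P₁₁ ᵀ) j ⟩ + ⟨ drop a (Y p) , (P₂₁ ᵀ) j ⟩
    ·-↑ˡ Y p j = trans (⟨⟩-↑ a (Y p) _)
      (cong₂ _+_ (⟨⟩-congʳ (take a (Y p)) (λ l → ↑ˡ-↑ˡ l j))
                 (⟨⟩-congʳ (drop a (Y p)) (λ l → ↑ʳ-↑ˡ l j)))

    ·-↑ʳ : ∀ {m} (Y : Mat m (a +ℕ b)) p j →
           (Y · P) p (c ↑ʳ j) ≡ ⟨ take a (Y p) , (P₁₂ ᵀ) j ⟩ + ⟨ drop a (Y p) , (P₂₂ ᵀ) j ⟩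
    ·-↑ʳ Y p j = trans (⟨⟩-↑ a (Y p) _)
      (cong₂ _+_ (⟨⟩-congʳ (take a (Y p)) (λ l → ↑ˡ-↑ʳ l j))
                 (⟨⟩-congʳ (drop a (Y p)) (λ l → ↑ʳ-↑ʳ l j)))

    private
      gram-↑ˡ-↑ˡ : ∀ i j → ⟨ P (i ↑ˡ b) , P (j ↑ˡ b) ⟩ ≡ ⟨ P₁₁ i , P₁₁ j ⟩ + ⟨ P₁₂ i , P₁₂ j ⟩
      gram-↑ˡ-↑ˡ i j = trans (⟨⟩-↑ c _ _)
        (cong₂ _+_ (⟨⟩-cong (↑ˡ-↑ˡ i) (↑ˡ-↑ˡ j)) (⟨⟩-cong (↑ˡ-↑ʳ i) (↑ˡ-↑ʳ j)))

      gram-↑ˡ-↑ʳ : ∀ i j → ⟨ P (i ↑ˡ b) , P (a ↑ʳ j) ⟩ ≡ ⟨ P₁₁ i , P₂₁ j ⟩ + ⟨ P₁₂ i , P₂₂ j ⟩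
      gram-↑ˡ-↑ʳ i j = trans (⟨⟩-↑ c _ _)
        (cong₂ _+_ (⟨⟩-cong (↑ˡ-↑ˡ i) (↑ʳ-↑ˡ j)) (⟨⟩-cong (↑ˡ-↑ʳ i) (↑ʳ-↑ʳ j)))

      gram-↑ʳ-↑ʳ : ∀ i j → ⟨ P (a ↑ʳ i) , P (a ↑ʳ j) ⟩ ≡ ⟨ P₂₁ i , P₂₁ j ⟩ + ⟨ P₂₂ i , P₂₂ j ⟩
      gram-↑ʳ-↑ʳ i j = trans (⟨⟩-↑ c _ _)
        (cong₂ _+_ (⟨⟩-cong (↑ʳ-↑ˡ i) (↑ʳ-↑ˡ j)) (⟨⟩-cong (↑ʳ-↑ʳ i) (↑ʳ-↑ʳ j)))

    rowOrthogonal⁻ : RowOrthogonal P → RowOrthogonalBlocks P₁₁ P₁₂ P₂₁ P₂₂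
    rowOrthogonal⁻ PPᵀ≡I = record
      { top    = λ i j → trans (sym (gram-↑ˡ-↑ˡ i j))
                           (trans (PPᵀ≡I (i ↑ˡ b) (j ↑ˡ b)) (I-↑ˡ-↑ˡ a b i j))
      ; cross  = λ i j → trans (sym (gram-↑ˡ-↑ʳ i j))
                           (trans (PPᵀ≡I (i ↑ˡ b) (a ↑ʳ j)) (I-↑ˡ-↑ʳ a b i j))
      ; bottom = λ i j → trans (sym (gram-↑ʳ-↑ʳ i j))
                           (trans (PPᵀ≡I (a ↑ʳ i) (a ↑ʳ j)) (I-↑ʳ-↑ʳ a b i j))
      }

    rowOrthogonal⁺ : RowOrthogonalBlocks P₁₁ P₁₂ P₂₁ P₂₂ → RowOrthogonal P
    rowOrthogonal⁺ blocks = ↑-elim² a a {C = λ p q → ⟨ P p , P q ⟩ ≡ I p q}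
      (λ i j → trans (gram-↑ˡ-↑ˡ i j) (trans (top i j) (sym (I-↑ˡ-↑ˡ a b i j))))
      (λ i j → trans (gram-↑ˡ-↑ʳ i j) (trans (cross i j) (sym (I-↑ˡ-↑ʳ a b i j))))
      (λ i j → trans (⟨⟩-comm (P (a ↑ʳ i)) _)
                 (trans (gram-↑ˡ-↑ʳ j i) (trans (cross j i) (sym (I-↑ʳ-↑ˡ a b i j)))))
      (λ i j → trans (gram-↑ʳ-↑ʳ i j) (trans (bottom i j) (sym (I-↑ʳ-↑ʳ a b i j))))
      where open RowOrthogonalBlocks blocks

  block-symmetric : ∀ {a b} {P₁₁ : Mat a a} {P₁₂ : Mat a b} {P₂₁ : Mat b a} {P₂₂ : Mat b b} →
                    Symmetric P₁₁ → (∀ i j → P₁₂ i j ≡ P₂₁ j i) → Symmetric P₂₂ →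
                    Symmetric (block P₁₁ P₁₂ P₂₁ P₂₂)
  block-symmetric {a} {b} {P₁₁} {P₁₂} {P₂₁} {P₂₂} sym₁₁ P₁₂≡P₂₁ᵀ sym₂₂ =
    ↑-elim² a a {C = λ p q → P p q ≡ P q p}
      (λ i j → trans (↑ˡ-↑ˡ i j) (trans (sym₁₁ i j) (sym (↑ˡ-↑ˡ j i))))
      (λ i j → trans (↑ˡ-↑ʳ i j) (trans (P₁₂≡P₂₁ᵀ i j) (sym (↑ʳ-↑ˡ j i))))
      (λ i j → trans (↑ʳ-↑ˡ i j) (trans (sym (P₁₂≡P₂₁ᵀ j i)) (sym (↑ˡ-↑ʳ j i))))
      (λ i j → trans (↑ʳ-↑ʳ i j) (trans (sym₂₂ i j) (sym (↑ʳ-↑ʳ j i))))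
    where open Block P₁₁ P₁₂ P₂₁ P₂₂

  TrivialSymmetricSolutions : ∀ {p q} → Mat p q → Set
  TrivialSymmetricSolutions {p} P =
    ∀ (X : Mat p p) → Symmetric X → (∀ i j → ((X · P) ∘ P) i j ≡ 0#) → ∀ i j → X i j ≡ 0#

  module Bordered {r s t w} (A : Mat r s) (v : Vect r) (u : Vect s)
                  (x : Vect t) (y : Vect w) (B : Mat w t) where

    M : Mat (r +ℕ 1) (s +ℕ 1)
    M = block A (col v) (row u) O

    N : Mat (1 +ℕ w) (1 +ℕ t)
    N = block O (row x) (col y) B

    Q : Mat (r +ℕ w) (s +ℕ t)
    Q = block A (outer v x) (outer y u) B

    module Mᵇ = Block A (col v) (row u) (O {1} {1})
    module Nᵇ = Block (O {1} {1}) (row x) (col y) B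
    module Qᵇ = Block A (outer v x) (outer y u) B

    module _ (MMᵀ≡I : RowOrthogonal M) (NNᵀ≡I : RowOrthogonal N) where
      private
        module Mᴿ = RowOrthogonalBlocks (Mᵇ.rowOrthogonal⁻ MMᵀ≡I)
        module Nᴿ = RowOrthogonalBlocks (Nᵇ.rowOrthogonal⁻ NNᵀ≡I)

      u·u≡1 : ⟨ u , u ⟩ ≡ 1#
      u·u≡1 = x+0≡y⇒x≡y (⟨⟩-zeroʳ (O {1} {1} zero) (λ _ → refl)) (Mᴿ.bottom zero zero)

      u⊥A : ∀ i → ⟨ u , A i ⟩ ≡ 0#
      u⊥A i = trans (⟨⟩-comm u (A i))
                (x+0≡y⇒x≡y (⟨⟩-zeroʳ (col v i) (λ _ → refl)) (Mᴿ.cross i zero))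

      x·x≡1 : ⟨ x , x ⟩ ≡ 1#
      x·x≡1 = 0+x≡y⇒x≡y (⟨⟩-zeroʳ (O {1} {1} zero) (λ _ → refl)) (Nᴿ.top zero zero)

      x⊥B : ∀ j → ⟨ x , B j ⟩ ≡ 0#
      x⊥B j = 0+x≡y⇒x≡y (⟨⟩-zeroˡ (col y j) (λ _ → refl)) (Nᴿ.cross zero j)

      Q-rowOrthogonal : RowOrthogonal Q
      Q-rowOrthogonal = Qᵇ.rowOrthogonal⁺ record
        { top    = λ i j → trans (cong (⟨ A i , A j ⟩ +_) (⟨⟩-outer v x x·x≡1 i j)) (Mᴿ.top i j)
        ; cross  = cross
        ; bottom = λ i j → trans (cong (_+ ⟨ B i , B j ⟩) (⟨⟩-outer y u u·u≡1 i j)) (Nᴿ.bottom i j)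
        }
        where
        cross : ∀ i j → ⟨ A i , outer y u j ⟩ + ⟨ outer v x i , B j ⟩ ≡ 0#
        cross i j = begin
          ⟨ A i , outer y u j ⟩ + ⟨ outer v x i , B j ⟩
            ≡⟨ cong₂ _+_ (trans (⟨⟩-comm (A i) _) (⟨⟩-*ˡ (y j) u (A i))) (⟨⟩-*ˡ (v i) x (B j)) ⟩
          y j * ⟨ u , A i ⟩ + v i * ⟨ x , B j ⟩
            ≡⟨ cong₂ _+_ (cong (y j *_) (u⊥A i)) (cong (v i *_) (x⊥B j)) ⟩
          y j * 0# + v i * 0#
            ≡⟨ cong₂ _+_ (zeroʳ (y j)) (zeroʳ (v i)) ⟩
          0# + 0#
            ≡⟨ +-identityʳ 0# ⟩
          0# ∎

      module _ (x≢0 : NowhereZero x) (y≢0 : NowhereZero y)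
               (u≢0 : NowhereZero u) (v≢0 : NowhereZero v)
               (X : Mat (r +ℕ w) (r +ℕ w)) (X-sym : Symmetric X)
               (XQ∘Q≡0 : ∀ p q → ((X · Q) ∘ Q) p q ≡ 0#) where

        X₁₁ : Mat r r
        X₁₁ i j = X (i ↑ˡ w) (j ↑ˡ w)

        X₁₂ : Mat r w
        X₁₂ i j = X (i ↑ˡ w) (r ↑ʳ j)

        X₂₁ : Mat w r
        X₂₁ i j = X (r ↑ʳ i) (j ↑ˡ w)

        X₂₂ : Mat w w
        X₂₂ i j = X (r ↑ʳ i) (r ↑ʳ j)

        XQ≡0 : ∀ {p q} → Q p q ≢ 0# → (X · Q) p q ≡ 0#
        XQ≡0 {p} {q} Qpq≢0 = x*y≡0⇒x≡0 Qpq≢0 (XQ∘Q≡0 p q)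

        XQ-top-right : ∀ i j → ⟨ X₁₁ i , v ⟩ * x j + (X₁₂ · B) i j ≡ 0#
        XQ-top-right i j = begin
          ⟨ X₁₁ i , v ⟩ * x j + ⟨ X₁₂ i , (B ᵀ) j ⟩
            ≡⟨ cong (_+ ⟨ X₁₂ i , (B ᵀ) j ⟩) (⟨⟩-*ʳ (x j) (X₁₁ i) v) ⟨
          ⟨ X₁₁ i , (outer v x ᵀ) j ⟩ + ⟨ X₁₂ i , (B ᵀ) j ⟩
            ≡⟨ Qᵇ.·-↑ʳ X (i ↑ˡ w) j ⟨
          (X · Q) (i ↑ˡ w) (s ↑ʳ j)
            ≡⟨ XQ≡0 (subst (_≢ 0#) (sym (Qᵇ.↑ˡ-↑ʳ i j)) (*-nonzero (v≢0 i) (x≢0 j))) ⟩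
          0# ∎

        XQ-bottom-left : ∀ i j → ⟨ X₂₂ i , y ⟩ * u j + (X₂₁ · A) i j ≡ 0#
        XQ-bottom-left i j = begin
          ⟨ X₂₂ i , y ⟩ * u j + ⟨ X₂₁ i , (A ᵀ) j ⟩
            ≡⟨ +-comm _ _ ⟩
          ⟨ X₂₁ i , (A ᵀ) j ⟩ + ⟨ X₂₂ i , y ⟩ * u j
            ≡⟨ cong (⟨ X₂₁ i , (A ᵀ) j ⟩ +_) (⟨⟩-*ʳ (u j) (X₂₂ i) y) ⟨
          ⟨ X₂₁ i , (A ᵀ) j ⟩ + ⟨ X₂₂ i , (outer y u ᵀ) j ⟩
            ≡⟨ Qᵇ.·-↑ˡ X (r ↑ʳ i) j ⟨
          (X · Q) (r ↑ʳ i) (j ↑ˡ t)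
            ≡⟨ XQ≡0 (subst (_≢ 0#) (sym (Qᵇ.↑ʳ-↑ˡ i j)) (*-nonzero (y≢0 i) (u≢0 j))) ⟩
          0# ∎

        X₁₁v≡0 : ∀ i → ⟨ X₁₁ i , v ⟩ ≡ 0#
        X₁₁v≡0 i = proj₁ (orthogonal-sum≡0⇒parts≡0 _ (X₁₂ i) x·x≡1 x⊥B (XQ-top-right i))

        X₁₂B≡0 : ∀ i j → (X₁₂ · B) i j ≡ 0#
        X₁₂B≡0 i = proj₂ (orthogonal-sum≡0⇒parts≡0 _ (X₁₂ i) x·x≡1 x⊥B (XQ-top-right i))

        X₂₂y≡0 : ∀ i → ⟨ X₂₂ i , y ⟩ ≡ 0#
        X₂₂y≡0 i = proj₁ (orthogonal-sum≡0⇒parts≡0 _ (X₂₁ i) u·u≡1 u⊥A (XQ-bottom-left i))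

        X₂₁A≡0 : ∀ i j → (X₂₁ · A) i j ≡ 0#
        X₂₁A≡0 i = proj₂ (orthogonal-sum≡0⇒parts≡0 _ (X₂₁ i) u·u≡1 u⊥A (XQ-bottom-left i))

        -- The borders a = X₁₂y and b = X₂₁v are written as yᵀX₂₁ and vᵀX₁₂, so that aᵀA = 0 and
        -- bᵀB = 0 are instances of ⟨⟩-assoc.
        a : Vect r
        a i = ⟨ y , (X₂₁ ᵀ) i ⟩

        a≡X₁₂y : ∀ i → a i ≡ ⟨ X₁₂ i , y ⟩
        a≡X₁₂y i = trans (⟨⟩-comm y _) (⟨⟩-congˡ y (λ m → X-sym (r ↑ʳ m) (i ↑ˡ w)))

        X′ : Mat (r +ℕ 1) (r +ℕ 1)
        X′ = block X₁₁ (col a) (row a) O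

        module X′ᵇ = Block X₁₁ (col a) (row a) (O {1} {1})

        X′-symmetric : Symmetric X′
        X′-symmetric = block-symmetric (λ i j → X-sym (i ↑ˡ w) (j ↑ˡ w)) (λ _ _ → refl) (λ _ _ → refl)

        X′M≡XQ : ∀ i j → (X′ · M) (i ↑ˡ 1) (j ↑ˡ 1) ≡ (X · Q) (i ↑ˡ w) (j ↑ˡ t)
        X′M≡XQ i j = begin
          (X′ · M) (i ↑ˡ 1) (j ↑ˡ 1)
            ≡⟨ Mᵇ.·-↑ˡ X′ (i ↑ˡ 1) j ⟩
          ⟨ take r (X′ (i ↑ˡ 1)) , (A ᵀ) j ⟩ + ⟨ drop r (X′ (i ↑ˡ 1)) , (row u ᵀ) j ⟩
            ≡⟨ cong₂ _+_ (⟨⟩-congˡ ((A ᵀ) j) (X′ᵇ.↑ˡ-↑ˡ i))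
                         (trans (⟨⟩-congˡ ((row u ᵀ) j) (X′ᵇ.↑ˡ-↑ʳ i)) (+-identityʳ _)) ⟩
          ⟨ X₁₁ i , (A ᵀ) j ⟩ + a i * u j
            ≡⟨ cong (λ z → ⟨ X₁₁ i , (A ᵀ) j ⟩ + z * u j) (a≡X₁₂y i) ⟩
          ⟨ X₁₁ i , (A ᵀ) j ⟩ + ⟨ X₁₂ i , y ⟩ * u j
            ≡⟨ cong (⟨ X₁₁ i , (A ᵀ) j ⟩ +_) (⟨⟩-*ʳ (u j) (X₁₂ i) y) ⟨
          ⟨ X₁₁ i , (A ᵀ) j ⟩ + ⟨ X₁₂ i , (outer y u ᵀ) j ⟩
            ≡⟨ Qᵇ.·-↑ˡ X (i ↑ˡ w) j ⟨
          (X · Q) (i ↑ˡ w) (j ↑ˡ t) ∎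

        X′M∘M≡0 : ∀ p q → ((X′ · M) ∘ M) p q ≡ 0#
        X′M∘M≡0 = ↑-elim² r s {C = λ p q → ((X′ · M) ∘ M) p q ≡ 0#}
          (λ i j → trans (cong₂ _*_ (X′M≡XQ i j) (trans (Mᵇ.↑ˡ-↑ˡ i j) (sym (Qᵇ.↑ˡ-↑ˡ i j))))
                         (XQ∘Q≡0 (i ↑ˡ w) (j ↑ˡ t)))
          (λ i j → trans (cong (_* M (i ↑ˡ 1) (s ↑ʳ j)) (X′M-top-right i j)) (zeroˡ _))
          (λ i j → trans (cong (_* M (r ↑ʳ i) (j ↑ˡ 1)) (X′M-bottom-left i j)) (zeroˡ _))
          (λ i j → trans (cong ((X′ · M) (r ↑ʳ i) (s ↑ʳ j) *_) (Mᵇ.↑ʳ-↑ʳ i j)) (zeroʳ _))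
          where
          X′M-top-right : ∀ i j → (X′ · M) (i ↑ˡ 1) (s ↑ʳ j) ≡ 0#
          X′M-top-right i j = trans (Mᵇ.·-↑ʳ X′ (i ↑ˡ 1) j)
            (trans (cong₂ _+_ (trans (⟨⟩-congˡ v (X′ᵇ.↑ˡ-↑ˡ i)) (X₁₁v≡0 i))
                              (⟨⟩-zeroʳ (drop r (X′ (i ↑ˡ 1))) (λ _ → refl)))
                   (+-identityʳ 0#))

          aᵀA≡0 : ∀ j → ⟨ a , (A ᵀ) j ⟩ ≡ 0#
          aᵀA≡0 j = trans (sym (⟨⟩-assoc y X₂₁ ((A ᵀ) j)))
                          (⟨⟩-zeroʳ y (λ m → X₂₁A≡0 m j))

          X′M-bottom-left : ∀ i j → (X′ · M) (r ↑ʳ i) (j ↑ˡ 1) ≡ 0#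
          X′M-bottom-left i j = trans (Mᵇ.·-↑ˡ X′ (r ↑ʳ i) j)
            (trans (cong₂ _+_ (trans (⟨⟩-congˡ ((A ᵀ) j) (X′ᵇ.↑ʳ-↑ˡ i)) (aᵀA≡0 j))
                              (⟨⟩-zeroˡ ((row u ᵀ) j) (X′ᵇ.↑ʳ-↑ʳ i)))
                   (+-identityʳ 0#))

        b : Vect w
        b i = ⟨ v , (X₁₂ ᵀ) i ⟩

        b≡X₂₁v : ∀ i → b i ≡ ⟨ X₂₁ i , v ⟩
        b≡X₂₁v i = trans (⟨⟩-comm v _) (⟨⟩-congˡ v (λ l → X-sym (l ↑ˡ w) (r ↑ʳ i)))

        X″ : Mat (1 +ℕ w) (1 +ℕ w)
        X″ = block O (row b) (col b) X₂₂

        module X″ᵇ = Block (O {1} {1}) (row b) (col b) X₂₂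

        X″-symmetric : Symmetric X″
        X″-symmetric = block-symmetric (λ _ _ → refl) (λ _ _ → refl) (λ i j → X-sym (r ↑ʳ i) (r ↑ʳ j))

        X″N≡XQ : ∀ i j → (X″ · N) (1 ↑ʳ i) (1 ↑ʳ j) ≡ (X · Q) (r ↑ʳ i) (s ↑ʳ j)
        X″N≡XQ i j = begin
          (X″ · N) (1 ↑ʳ i) (1 ↑ʳ j)
            ≡⟨ Nᵇ.·-↑ʳ X″ (1 ↑ʳ i) j ⟩
          ⟨ take 1 (X″ (1 ↑ʳ i)) , (row x ᵀ) j ⟩ + ⟨ drop 1 (X″ (1 ↑ʳ i)) , (B ᵀ) j ⟩
            ≡⟨ cong₂ _+_ (trans (⟨⟩-congˡ ((row x ᵀ) j) (X″ᵇ.↑ʳ-↑ˡ i)) (+-identityʳ _))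
                         (⟨⟩-congˡ ((B ᵀ) j) (X″ᵇ.↑ʳ-↑ʳ i)) ⟩
          b i * x j + ⟨ X₂₂ i , (B ᵀ) j ⟩
            ≡⟨ cong (λ z → z * x j + ⟨ X₂₂ i , (B ᵀ) j ⟩) (b≡X₂₁v i) ⟩
          ⟨ X₂₁ i , v ⟩ * x j + ⟨ X₂₂ i , (B ᵀ) j ⟩
            ≡⟨ cong (_+ ⟨ X₂₂ i , (B ᵀ) j ⟩) (⟨⟩-*ʳ (x j) (X₂₁ i) v) ⟨
          ⟨ X₂₁ i , (outer v x ᵀ) j ⟩ + ⟨ X₂₂ i , (B ᵀ) j ⟩
            ≡⟨ Qᵇ.·-↑ʳ X (r ↑ʳ i) j ⟨
          (X · Q) (r ↑ʳ i) (s ↑ʳ j) ∎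

        X″N∘N≡0 : ∀ p q → ((X″ · N) ∘ N) p q ≡ 0#
        X″N∘N≡0 = ↑-elim² 1 1 {C = λ p q → ((X″ · N) ∘ N) p q ≡ 0#}
          (λ i j → trans (cong ((X″ · N) (i ↑ˡ w) (j ↑ˡ t) *_) (Nᵇ.↑ˡ-↑ˡ i j)) (zeroʳ _))
          (λ i j → trans (cong (_* N (i ↑ˡ w) (1 ↑ʳ j)) (X″N-top-right i j)) (zeroˡ _))
          (λ i j → trans (cong (_* N (1 ↑ʳ i) (j ↑ˡ t)) (X″N-bottom-left i j)) (zeroˡ _))
          (λ i j → trans (cong₂ _*_ (X″N≡XQ i j) (trans (Nᵇ.↑ʳ-↑ʳ i j) (sym (Qᵇ.↑ʳ-↑ʳ i j))))
                         (XQ∘Q≡0 (r ↑ʳ i) (s ↑ʳ j)))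
          where
          bᵀB≡0 : ∀ j → ⟨ b , (B ᵀ) j ⟩ ≡ 0#
          bᵀB≡0 j = trans (sym (⟨⟩-assoc v X₁₂ ((B ᵀ) j)))
                          (⟨⟩-zeroʳ v (λ l → X₁₂B≡0 l j))

          X″N-top-right : ∀ i j → (X″ · N) (i ↑ˡ w) (1 ↑ʳ j) ≡ 0#
          X″N-top-right i j = trans (Nᵇ.·-↑ʳ X″ (i ↑ˡ w) j)
            (trans (cong₂ _+_ (⟨⟩-zeroˡ ((row x ᵀ) j) (X″ᵇ.↑ˡ-↑ˡ i))
                              (trans (⟨⟩-congˡ ((B ᵀ) j) (X″ᵇ.↑ˡ-↑ʳ i)) (bᵀB≡0 j)))
                   (+-identityʳ 0#))

          X″N-bottom-left : ∀ i j → (X″ · N) (1 ↑ʳ i) (j ↑ˡ t) ≡ 0#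
          X″N-bottom-left i j = trans (Nᵇ.·-↑ˡ X″ (1 ↑ʳ i) j)
            (trans (cong₂ _+_ (⟨⟩-zeroʳ (take 1 (X″ (1 ↑ʳ i))) (λ _ → refl))
                              (trans (⟨⟩-congˡ y (X″ᵇ.↑ʳ-↑ʳ i)) (X₂₂y≡0 i)))
                   (+-identityʳ 0#))

        module _ (M-trivial : TrivialSymmetricSolutions M)
                 (N-trivial : TrivialSymmetricSolutions N) where

          X′≡0 : ∀ p q → X′ p q ≡ 0#
          X′≡0 = M-trivial X′ X′-symmetric X′M∘M≡0

          X″≡0 : ∀ p q → X″ p q ≡ 0#
          X″≡0 = N-trivial X″ X″-symmetric X″N∘N≡0

          X₁₂y≡0 : ∀ i → ⟨ X₁₂ i , y ⟩ ≡ 0#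
          X₁₂y≡0 i = trans (sym (a≡X₁₂y i))
                       (trans (sym (X′ᵇ.↑ˡ-↑ʳ i zero)) (X′≡0 (i ↑ˡ 1) (r ↑ʳ zero)))

          X₁₂≡0 : ∀ i j → X₁₂ i j ≡ 0#
          X₁₂≡0 i j = rowOrthogonal⇒fullRowRank N NNᵀ≡I (0# ∷ X₁₂ i) [0,X₁₂]N≡0 (suc j)
            where
            [0,X₁₂]N≡0 : ∀ k → ⟨ 0# ∷ X₁₂ i , (N ᵀ) k ⟩ ≡ 0#
            [0,X₁₂]N≡0 = ↑-elim 1 {C = λ k → ⟨ 0# ∷ X₁₂ i , (N ᵀ) k ⟩ ≡ 0#}
              (λ k → trans (cong₂ _+_ (zeroˡ _)
                              (trans (⟨⟩-congʳ (X₁₂ i) (λ m → Nᵇ.↑ʳ-↑ˡ m k)) (X₁₂y≡0 i)))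
                           (+-identityʳ 0#))
              (λ k → trans (cong₂ _+_ (zeroˡ _)
                              (trans (⟨⟩-congʳ (X₁₂ i) (λ m → Nᵇ.↑ʳ-↑ʳ m k)) (X₁₂B≡0 i k)))
                           (+-identityʳ 0#))

          X≡0 : ∀ p q → X p q ≡ 0#
          X≡0 = ↑-elim² r r {C = λ p q → X p q ≡ 0#}
            (λ i j → trans (sym (X′ᵇ.↑ˡ-↑ˡ i j)) (X′≡0 (i ↑ˡ 1) (j ↑ˡ 1)))
            X₁₂≡0
            (λ i j → trans (X-sym (r ↑ʳ i) (j ↑ˡ w)) (X₁₂≡0 j i))
            (λ i j → trans (sym (X″ᵇ.↑ʳ-↑ʳ i j)) (X″≡0 (1 ↑ʳ i) (1 ↑ʳ j)))

      Q-SIPP : NowhereZero x → NowhereZero y → NowhereZero u → NowhereZero v →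
               SIPP M → SIPP N → SIPP Q
      Q-SIPP x≢0 y≢0 u≢0 v≢0 (r+1≤s+1 , _ , M-trivial) (1+w≤1+t , _ , N-trivial) =
        ℕ.+-mono-≤ (ℕ.+-cancelʳ-≤ 1 r s r+1≤s+1) (ℕ.+-cancelˡ-≤ 1 w t 1+w≤1+t) ,
        rowOrthogonal⇒fullRowRank Q Q-rowOrthogonal ,
        λ X X-sym XQ∘Q≡0 → X≡0 x≢0 y≢0 u≢0 v≢0 X X-sym XQ∘Q≡0 M-trivial N-trivial

proposition5p11 :
  (R : RealField) → let open Matrices R in
  ∀ {r s t w : ℕ}
    (A : Mat r s) (v : Vect r) (u : Vect s)
    (x : Vect t) (y : Vect w) (B : Mat w t) →
    NowhereZero x → NowhereZero y → NowhereZero u → NowhereZero v →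
    RowOrthogonal (block A (col v) (row u) (O {1} {1})) →
    RowOrthogonal (block (O {1} {1}) (row x) (col y) B) →
    RowOrthogonal (block A (outer v x) (outer y u) B) ×
    (SIPP (block A (col v) (row u) (O {1} {1})) →
     SIPP (block (O {1} {1}) (row x) (col y) B) →
     SIPP (block A (outer v x) (outer y u) B))
proposition5p11 R A v u x y B x≢0 y≢0 u≢0 v≢0 MMᵀ≡I NNᵀ≡I =
  Q-rowOrthogonal MMᵀ≡I NNᵀ≡I , Q-SIPP MMᵀ≡I NNᵀ≡I x≢0 y≢0 u≢0 v≢0
  where open Bordered R A v u x y B
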